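{- Let $g:\{0,1\}^N\to\{0,1\}$ and $n\in\mathbb N$, and let $f_{and}=AND_n\circ g^n$ and $f_{or}=OR_n\circ g^n$ (functions on $\{0,1\}^{Nn}$, $f_{and}(x^{(1)},\dots,x^{(n)})=AND_n(g(x^{(1)}),\dots,g(x^{(n)}))$ and similarly for $OR_n$). Then $D(f_{and})=D(f_{or})=nD(g)$; $C_0(f_{or})=nC_0(g)$, $C_1(f_{or})=C_1(g)$; $C_0(f_{and})=C_0(g)$, $C_1(f_{and})=nC_1(g)$; $UP_0(f_{or})\le nUP_0(g)$, $UP_1(f_{or})\le (n-1)UP_0(g)+UP_1(g)$; $UP_0(f_{and})\le (n-1)UP_1(g)+UP_0(g)$, $UP_1(f_{and})\le nUP_1(g)$.
   Context: $AND_n$ and $OR_n$ are the usual $n$-bit AND and OR. For a Boolean function $g$: $D(g)$ is the deterministic query (decision tree) complexity. A partial assignment fixes values of some variables; its length is the number of fixed variables; its subcube is the set of inputs agreeing with it. A $b$-certificate is a partial assignment forcing the function value $b$. $C_b(g)$ is the least $k$ such that every $b$-input is consistent with a $b$-certificate of length $\le k$. $UP_b(g)$ is the least $k$ such that $g^{ -1}(b)$ is a disjoint union of subcubes each defined by an assignment of length $\le k$. -}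

module Defs where

open import Data.Nat using (ℕ; zero; suc; _+_; _*_; _≤_; _⊔_)
open import Data.Bool using (Bool; true; false; _∧_; _∨_; if_then_else_)
open import Data.Fin using (Fin; combine)
import Data.Fin as Fin
open import Data.Maybe using (Maybe; just; nothing; is-just)
open import Data.Product using (Σ; ∃; _×_; _,_)
open import Relation.Binary.PropositionalEquality using (_≡_)

Input : ℕ → Set
Input m = Fin m → Bool

BoolFun : ℕ → Set
BoolFun m = Input m → Bool

AND : (n : ℕ) → BoolFun n
AND zero    x = true
AND (suc n) x = x Fin.zero ∧ AND n (λ i → x (Fin.suc i))

OR : (n : ℕ) → BoolFun n
OR zero    x = false
OR (suc n) x = x Fin.zero ∨ OR n (λ i → x (Fin.suc i))

-- Composition h ∘ g^n on {0,1}^(n*N): the i-th block of the input is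
-- x^(i) = (x (combine i j))_{j : Fin N}.
compose : {n N : ℕ} → BoolFun n → BoolFun N → BoolFun (n * N)
compose {n} h g x = h (λ i → g (λ j → x (combine i j)))

IsLeast : (ℕ → Set) → ℕ → Set
IsLeast P d = P d × (∀ k → P k → d ≤ k)

data DTree (m : ℕ) : Set where
  leaf : Bool → DTree m
  node : Fin m → DTree m → DTree m → DTree m   -- query x_i; left if 0, right if 1

eval : {m : ℕ} → DTree m → Input m → Bool
eval (leaf b)     x = b
eval (node i l r) x = if x i then eval r x else eval l x

depth : {m : ℕ} → DTree m → ℕ
depth (leaf b)     = 0
depth (node i l r) = suc (depth l ⊔ depth r)

Computes : {m : ℕ} → DTree m → BoolFun m → Set
Computes t f = ∀ x → eval t x ≡ f x

IsD : {m : ℕ} → BoolFun m → ℕ → Set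
IsD {m} f = IsLeast (λ k → Σ (DTree m) λ t → Computes t f × depth t ≤ k)

PartialAssignment : ℕ → Set
PartialAssignment m = Fin m → Maybe Bool

len : {m : ℕ} → PartialAssignment m → ℕ
len {zero}  ρ = 0
len {suc m} ρ = (if is-just (ρ Fin.zero) then 1 else 0) + len (λ i → ρ (Fin.suc i))

Consistent : {m : ℕ} → Input m → PartialAssignment m → Set
Consistent x ρ = ∀ i b → ρ i ≡ just b → x i ≡ b

IsCertificate : {m : ℕ} → BoolFun m → Bool → PartialAssignment m → Set
IsCertificate f b ρ = ∀ x → Consistent x ρ → f x ≡ b

IsC : {m : ℕ} → Bool → BoolFun m → ℕ → Set
IsC {m} b f = IsLeast (λ k → ∀ x → f x ≡ b →
  Σ (PartialAssignment m) λ ρ → IsCertificate f b ρ × Consistent x ρ × len ρ ≤ k)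

DisjointCubeCover : {m : ℕ} → Bool → BoolFun m → ℕ → Set
DisjointCubeCover {m} b f k =
  Σ ℕ λ K → Σ (Fin K → PartialAssignment m) λ ρ →
    (∀ i → len (ρ i) ≤ k)
  × (∀ i → IsCertificate f b (ρ i))
  × (∀ x → f x ≡ b → Σ (Fin K) λ i → Consistent x (ρ i))
  × (∀ i j x → Consistent x (ρ i) → Consistent x (ρ j) → i ≡ j)

IsUP : {m : ℕ} → Bool → BoolFun m → ℕ → Set
IsUP b f = IsLeast (DisjointCubeCover b f)

-- AND_(n+1) ∘ g^(n+1) is literally g ⊗ (AND_n ∘ g^n), where (G ⊗ H)(y, z) = G y ∧ H z
-- is the conjunction of functions on disjoint blocks of variables, so every
-- statement about AND follows by induction on n from a statement about ⊗:
--   D:  trees for G and H combine (graft) into one for G ⊗ H; conversely, for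
--       satisfiable G, H a tree for G ⊗ H splits into trees for G and H of total
--       depth at most its depth (induction on the depth, restricting at the
--       root query, in the symmetric setting of two functions on complementary
--       sets of variables);
--   C:  certificates of the blocks concatenate; conversely the halves of a
--       certificate are certificates, and at (x, …, x) the shortest of the n
--       blocks has at most 1/n of the length;
--   UP: partitions of the blocks into subcubes multiply, and (G ⊗ H)⁻¹(0) is the
--       disjoint union of G⁻¹(0) × * and G⁻¹(1) × H⁻¹(0).
-- OR is reduced to AND by De Morgan, OR_n ∘ g^n = ¬ (AND_n ∘ (¬g)^n), since
-- negation preserves D and exchanges the values 0 and 1 in C_b and UP_b.
module Submission where

open import Defs
open import Function using (id; _∘_)
open import Data.Nat using (ℕ; zero; suc; _*_; _+_; _∸_; _≤_; _⊔_; z≤n; s≤s; _≤?_; _/_)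
open import Data.Nat.Properties
open import Data.Nat.DivMod using (m*n/n≡m; m/n*n≤m; /-monoˡ-≤)
open import Data.Bool using (Bool; true; false; _∧_; not; if_then_else_)
open import Data.Bool.Properties
  using (not-involutive; ¬-not; ∧-comm; ∧-conicalˡ; ∧-conicalʳ; ∧-identityʳ; ∧-zeroʳ)
import Data.Bool.Properties as Bool
open import Data.Fin using (Fin; _↑ˡ_; _↑ʳ_; splitAt; combine; remQuot)
import Data.Fin as Fin
import Data.Fin.Properties as Fin
open import Data.Vec.Functional using ([]; _∷_; tail)
open import Data.Maybe using (just; nothing; is-just)
open import Data.Product using (Σ; _×_; _,_; proj₁; proj₂)
open import Data.Sum using (_⊎_; inj₁; inj₂; [_,_]′)
open import Data.Empty using (⊥; ⊥-elim)
open import Data.Unit using (⊤; tt)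
open import Relation.Nullary using (yes; no; does)
open import Relation.Nullary.Decidable using (dec-true)
open import Relation.Binary.PropositionalEquality

false≢true : false ≢ true
false≢true ()

-- A Boolean function is extensional if it respects pointwise equality of
-- inputs.  Functions given by decision trees or certificates are extensional.
Ext : ∀ {m} → BoolFun m → Set
Ext f = ∀ x y → x ≗ y → f x ≡ f y

Sat : ∀ {m} → BoolFun m → Set
Sat {m} f = Σ (Input m) λ x → f x ≡ true

Unsat : ∀ {m} → BoolFun m → Set
Unsat f = ∀ x → f x ≡ false

Ext-cons : ∀ {m} (f : BoolFun (suc m)) → Ext f → ∀ b → Ext (λ x → f (b ∷ x))
Ext-cons f e b x y p = e _ _ λ { Fin.zero → refl ; (Fin.suc i) → p i }

decSat : ∀ {m} (f : BoolFun m) → Ext f → Sat f ⊎ Unsat f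
decSat {zero} f e with f [] in eq
... | true  = inj₁ ([] , eq)
... | false = inj₂ λ x → trans (e x [] λ ()) eq
decSat {suc m} f e with decSat (λ x → f (false ∷ x)) (Ext-cons f e false)
                      | decSat (λ x → f (true ∷ x)) (Ext-cons f e true)
... | inj₁ (x , p) | _            = inj₁ (false ∷ x , p)
... | inj₂ _       | inj₁ (x , p) = inj₁ (true ∷ x , p)
... | inj₂ u₀      | inj₂ u₁      = inj₂ λ x →
  trans (e x (x Fin.zero ∷ tail x) λ { Fin.zero → refl ; (Fin.suc i) → refl })
        (unsat-head (x Fin.zero) (tail x))
  where
  unsat-head : ∀ b xs → f (b ∷ xs) ≡ false
  unsat-head false = u₀
  unsat-head true  = u₁

module Blocks (N M : ℕ) where
  left : {A : Set} → (Fin (N + M) → A) → Fin N → A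
  left x i = x (i ↑ˡ M)

  right : {A : Set} → (Fin (N + M) → A) → Fin M → A
  right x j = x (N ↑ʳ j)

  _⊕_ : {A : Set} → (Fin N → A) → (Fin M → A) → Fin (N + M) → A
  (y ⊕ z) k = [ y , z ]′ (splitAt N k)

  left-⊕ : {A : Set} (y : Fin N → A) (z : Fin M → A) → left (y ⊕ z) ≗ y
  left-⊕ y z i rewrite Fin.splitAt-↑ˡ N i M = refl

  right-⊕ : {A : Set} (y : Fin N → A) (z : Fin M → A) → right (y ⊕ z) ≗ z
  right-⊕ y z j rewrite Fin.splitAt-↑ʳ N M j = refl

  by-blocks : (P : Fin (N + M) → Set) → (∀ i → P (i ↑ˡ M)) → (∀ j → P (N ↑ʳ j)) → ∀ k → P k
  by-blocks P pl pr k with splitAt N k in eq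
  ... | inj₁ i with refl ← Fin.splitAt⁻¹-↑ˡ eq = pl i
  ... | inj₂ j with refl ← Fin.splitAt⁻¹-↑ʳ eq = pr j

module _ {N M : ℕ} where
  open Blocks N M

  _⊗_ : BoolFun N → BoolFun M → BoolFun (N + M)
  (G ⊗ H) x = G (left x) ∧ H (right x)

  ⊗-ext : {G : BoolFun N} {H : BoolFun M} → Ext G → Ext H → Ext (G ⊗ H)
  ⊗-ext eG eH x y p = cong₂ _∧_ (eG _ _ (p ∘ (_↑ˡ M))) (eH _ _ (p ∘ (N ↑ʳ_)))

  ⊗-⊕ : {G : BoolFun N} {H : BoolFun M} → Ext G → Ext H → ∀ y z → (G ⊗ H) (y ⊕ z) ≡ G y ∧ H z
  ⊗-⊕ eG eH y z = cong₂ _∧_ (eG _ _ (left-⊕ y z)) (eH _ _ (right-⊕ y z))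

-- AND_n ∘ g^n; note that andBlocks (suc n) g is definitionally g ⊗ andBlocks n g.
andBlocks : ∀ {N} n → BoolFun N → BoolFun (n * N)
andBlocks n g = compose {n} (AND n) g

andBlocks-ext : ∀ {N} n {g : BoolFun N} → Ext g → Ext (andBlocks n g)
andBlocks-ext zero    eg x y p = refl
andBlocks-ext (suc n) eg = ⊗-ext eg (andBlocks-ext n eg)

rep : ∀ {N} n → Input N → Input (n * N)
rep zero    x = []
rep {N} (suc n) x = Blocks._⊕_ N (n * N) x (rep n x)

andBlocks-rep : ∀ {N} n {g : BoolFun N} → Ext g → ∀ {x} → g x ≡ true → andBlocks n g (rep n x) ≡ true
andBlocks-rep zero    eg gx = refl
andBlocks-rep (suc n) eg {x} gx =
  trans (⊗-⊕ eg (andBlocks-ext n eg) x (rep n x)) (cong₂ _∧_ gx (andBlocks-rep n eg gx))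

len-ext : ∀ {m} {ρ σ : PartialAssignment m} → ρ ≗ σ → len ρ ≡ len σ
len-ext {zero}  e = refl
len-ext {suc m} {ρ} e rewrite e Fin.zero = cong (_ +_) (len-ext (e ∘ Fin.suc))

len-blocks : ∀ N {M} (π : PartialAssignment (N + M)) →
  len π ≡ len (Blocks.left N M π) + len (Blocks.right N M π)
len-blocks zero    π = refl
len-blocks (suc N) π = trans (cong (first +_) (len-blocks N (π ∘ Fin.suc))) (sym (+-assoc first _ _))
  where
  first : ℕ
  first = if is-just (π Fin.zero) then 1 else 0

empty : ∀ {m} → PartialAssignment m
empty _ = nothing

len-empty : ∀ m → len (empty {m}) ≡ 0
len-empty zero    = refl
len-empty (suc m) = len-empty m

consistent-empty : ∀ {m} (x : Input m) → Consistent x empty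
consistent-empty x i b ()

consistent-resp : ∀ {m} {x y : Input m} {ρ σ : PartialAssignment m} →
  x ≗ y → ρ ≗ σ → Consistent x ρ → Consistent y σ
consistent-resp x≗y ρ≗σ c i b p = trans (sym (x≗y i)) (c i b (trans (ρ≗σ i) p))

module _ {N M : ℕ} where
  open Blocks N M

  len-⊕ : (ρ : PartialAssignment N) (σ : PartialAssignment M) → len (ρ ⊕ σ) ≡ len ρ + len σ
  len-⊕ ρ σ = trans (len-blocks N (ρ ⊕ σ)) (cong₂ _+_ (len-ext (left-⊕ ρ σ)) (len-ext (right-⊕ ρ σ)))

  consistent-left : ∀ {x : Input (N + M)} {π} → Consistent x π → Consistent (left x) (left π)
  consistent-left c i = c (i ↑ˡ M)

  consistent-right : ∀ {x : Input (N + M)} {π} → Consistent x π → Consistent (right x) (right π)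
  consistent-right c j = c (N ↑ʳ j)

  consistent-join : ∀ {x : Input (N + M)} {π} →
    Consistent (left x) (left π) → Consistent (right x) (right π) → Consistent x π
  consistent-join {x} {π} cl cr = by-blocks (λ k → ∀ b → π k ≡ just b → x k ≡ b) cl cr

  consistent-split : ∀ {x : Input (N + M)} {ρ σ} →
    Consistent x (ρ ⊕ σ) → Consistent (left x) ρ × Consistent (right x) σ
  consistent-split {ρ = ρ} {σ} c = consistent-resp (λ _ → refl) (left-⊕ ρ σ) (consistent-left c) ,
                                   consistent-resp (λ _ → refl) (right-⊕ ρ σ) (consistent-right c)

  consistent-merge : ∀ {x : Input (N + M)} {ρ σ} →
    Consistent (left x) ρ → Consistent (right x) σ → Consistent x (ρ ⊕ σ)
  consistent-merge {ρ = ρ} {σ} cl cr = consistent-join (consistent-resp (λ _ → refl) (sym ∘ left-⊕ ρ σ) cl)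
                                                       (consistent-resp (λ _ → refl) (sym ∘ right-⊕ ρ σ) cr)

  consistent-glue : ∀ {π} {y : Input N} {z : Input M} →
    Consistent y (left π) → Consistent z (right π) → Consistent (y ⊕ z) π
  consistent-glue {y = y} {z} cy cz = consistent-join (consistent-resp (sym ∘ left-⊕ y z) (λ _ → refl) cy)
                                                      (consistent-resp (sym ∘ right-⊕ y z) (λ _ → refl) cz)

eval-ext : ∀ {m} (t : DTree m) {x y} → x ≗ y → eval t x ≡ eval t y
eval-ext (leaf b)     p = refl
eval-ext (node i l r) {x} {y} p rewrite p i with y i
... | true  = eval-ext r p
... | false = eval-ext l p

computes-ext : ∀ {m} {t : DTree m} {f} → Computes t f → Ext f
computes-ext {t = t} c x y p = trans (sym (c x)) (trans (eval-ext t p) (c y))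

Subst : ℕ → ℕ → Set
Subst m m' = Fin m → Fin m' ⊎ Bool

apply : ∀ {m m'} → Subst m m' → Input m' → Input m
apply σ x k = [ x , id ]′ (σ k)

rename : ∀ {m m'} → Subst m m' → DTree m → DTree m'
rename σ (leaf b) = leaf b
rename σ (node k l r) with σ k
... | inj₁ k'    = node k' (rename σ l) (rename σ r)
... | inj₂ false = rename σ l
... | inj₂ true  = rename σ r

eval-rename : ∀ {m m'} (σ : Subst m m') t x → eval (rename σ t) x ≡ eval t (apply σ x)
eval-rename σ (leaf b) x = refl
eval-rename σ (node k l r) x with σ k
... | inj₁ k' with x k'
...   | true  = eval-rename σ r x
...   | false = eval-rename σ l x
eval-rename σ (node k l r) x | inj₂ false = eval-rename σ l x
eval-rename σ (node k l r) x | inj₂ true  = eval-rename σ r x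

depth-rename : ∀ {m m'} (σ : Subst m m') t → depth (rename σ t) ≤ depth t
depth-rename σ (leaf b) = z≤n
depth-rename σ (node k l r) with σ k
... | inj₁ k'    = s≤s (⊔-mono-≤ (depth-rename σ l) (depth-rename σ r))
... | inj₂ false = m≤n⇒m≤1+n (≤-trans (depth-rename σ l) (m≤m⊔n _ _))
... | inj₂ true  = m≤n⇒m≤1+n (≤-trans (depth-rename σ r) (m≤n⊔m _ _))

depth-rename-root : ∀ {m m'} (σ : Subst m m') {k b} l r → σ k ≡ inj₂ b →
  depth (rename σ (node k l r)) ≤ depth l ⊔ depth r
depth-rename-root σ {k} l r eq with σ k
depth-rename-root σ l r refl | inj₂ false = ≤-trans (depth-rename σ l) (m≤m⊔n _ _)
depth-rename-root σ l r refl | inj₂ true  = ≤-trans (depth-rename σ r) (m≤n⊔m _ _)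

assign : ∀ {m} → Fin m → Bool → Subst m m
assign k b k' = if does (k' Fin.≟ k) then inj₂ b else inj₁ k'

upd : ∀ {m} → Input m → Fin m → Bool → Input m
upd x k b = apply (assign k b) x

assign-same : ∀ {m} (k : Fin m) b → assign k b k ≡ inj₂ b
assign-same k b rewrite dec-true (k Fin.≟ k) refl = refl

upd-other : ∀ {m} (x : Input m) {k k'} b → k' ≢ k → upd x k b k' ≡ x k'
upd-other x {k} {k'} b k'≢k with k' Fin.≟ k
... | yes k'≡k = ⊥-elim (k'≢k k'≡k)
... | no  _    = refl

upd-self : ∀ {m} (x : Input m) k → upd x k (x k) ≗ x
upd-self x k k' with k' Fin.≟ k
... | yes refl = refl
... | no  _    = refl

upd-cong : ∀ {m} {x y : Input m} k b k' → x k' ≡ y k' → upd x k b k' ≡ upd y k b k'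
upd-cong k b k' p with k' Fin.≟ k
... | yes _ = refl
... | no  _ = p

upd-id : ∀ {m} (x : Input m) {k b} → x k ≡ b → upd x k b ≗ x
upd-id x {k} refl = upd-self x k

node-computes : ∀ {m} {G : BoolFun m} → Ext G → ∀ k {a₀ a₁} →
  Computes a₀ (λ x → G (upd x k false)) → Computes a₁ (λ x → G (upd x k true)) →
  Computes (node k a₀ a₁) G
node-computes eG k c₀ c₁ x with x k in p
... | true  = trans (c₁ x) (eG _ _ (upd-id x p))
... | false = trans (c₀ x) (eG _ _ (upd-id x p))

graft : ∀ {m} → DTree m → DTree m → DTree m
graft (leaf true)  t = t
graft (leaf false) t = leaf false
graft (node i l r) t = node i (graft l t) (graft r t)

eval-graft : ∀ {m} (s t : DTree m) x → eval (graft s t) x ≡ eval s x ∧ eval t x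
eval-graft (leaf true)  t x = refl
eval-graft (leaf false) t x = refl
eval-graft (node i l r) t x with x i
... | true  = eval-graft r t x
... | false = eval-graft l t x

depth-graft : ∀ {m} (s t : DTree m) → depth (graft s t) ≤ depth s + depth t
depth-graft (leaf true)  t = ≤-refl
depth-graft (leaf false) t = z≤n
depth-graft (node i l r) t = s≤s (begin
  depth (graft l t) ⊔ depth (graft r t) ≤⟨ ⊔-mono-≤ (depth-graft l t) (depth-graft r t) ⟩
  (depth l + depth t) ⊔ (depth r + depth t) ≡⟨ +-distribʳ-⊔ (depth t) (depth l) (depth r) ⟨
  depth l ⊔ depth r + depth t ∎)
  where open ≤-Reasoning

negate : ∀ {m} → DTree m → DTree m
negate (leaf b)     = leaf (not b)
negate (node i l r) = node i (negate l) (negate r)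

eval-negate : ∀ {m} (t : DTree m) x → eval (negate t) x ≡ not (eval t x)
eval-negate (leaf b)     x = refl
eval-negate (node i l r) x with x i
... | true  = eval-negate r x
... | false = eval-negate l x

depth-negate : ∀ {m} (t : DTree m) → depth (negate t) ≡ depth t
depth-negate (leaf b)     = refl
depth-negate (node i l r) = cong suc (cong₂ _⊔_ (depth-negate l) (depth-negate r))

SplitTrees : ∀ {m m'} → BoolFun m → BoolFun m' → ℕ → Set
SplitTrees {m} {m'} G H d = Σ (DTree m) λ tG → Σ (DTree m') λ tH →
  Computes tG G × Computes tH H × depth tG + depth tH ≤ d

split-swap : ∀ {m m'} {G : BoolFun m} {H : BoolFun m'} {d} → SplitTrees G H d → SplitTrees H G d
split-swap (tG , tH , cG , cH , p) = tH , tG , cH , cG , ≤-trans (≤-reflexive (+-comm (depth tH) (depth tG))) p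

split-weaken : ∀ {m m'} {G : BoolFun m} {H : BoolFun m'} {d d'} → d ≤ d' → SplitTrees G H d → SplitTrees G H d'
split-weaken d≤d' (tG , tH , cG , cH , p) = tG , tH , cG , cH , ≤-trans p d≤d'

DependsOn : ∀ {m} → (Fin m → Bool) → BoolFun m → Set
DependsOn S G = ∀ x y → (∀ k → S k ≡ true → x k ≡ y k) → G x ≡ G y

co : ∀ {m} → (Fin m → Bool) → Fin m → Bool
co S k = not (S k)

dependsOn-ext : ∀ {m} {S : Fin m → Bool} {G} → DependsOn S G → Ext G
dependsOn-ext d x y p = d x y λ k _ → p k

dependsOn-co-co : ∀ {m} {S : Fin m → Bool} {G} → DependsOn S G → DependsOn (co (co S)) G
dependsOn-co-co {S = S} d x y p = d x y λ k Sk → p k (trans (not-involutive (S k)) Sk)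

mix : ∀ {m} → (Fin m → Bool) → Input m → Input m → Input m
mix S x y k = if S k then x k else y k

mix-on : ∀ {m} (S : Fin m → Bool) {x y} k → S k ≡ true → mix S x y k ≡ x k
mix-on S k Sk rewrite Sk = refl

mix-off : ∀ {m} (S : Fin m → Bool) {x y} k → co S k ≡ true → mix S x y k ≡ y k
mix-off S k coSk with S k
mix-off S k () | true
mix-off S k _  | false = refl

mix-∧ : ∀ {m} (S : Fin m → Bool) {G H} → DependsOn S G → DependsOn (co S) H →
  ∀ x y → G (mix S x y) ∧ H (mix S x y) ≡ G x ∧ H y
mix-∧ S dG dH x y = cong₂ _∧_ (dG _ _ (mix-on S)) (dH _ _ (mix-off S))

Additive : ℕ → ℕ → Set
Additive m d = ∀ (S : Fin m → Bool) (T : DTree m) → depth T ≤ d → ∀ G H →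
  DependsOn S G → DependsOn (co S) H → Sat G → Sat H →
  Computes T (λ x → G x ∧ H x) → SplitTrees G H (depth T)

-- A constant tree for G ∧ H forces G and H to be constant true.
additive-leaf : ∀ {m} (S : Fin m → Bool) b {G H} → DependsOn S G → DependsOn (co S) H →
  Sat G → Sat H → Computes (leaf b) (λ x → G x ∧ H x) → SplitTrees G H 0
additive-leaf S false dG dH (y , Gy) (z , Hz) c =
  ⊥-elim (false≢true (trans (c (mix S y z)) (trans (mix-∧ S dG dH y z) (cong₂ _∧_ Gy Hz))))
additive-leaf S true {G} {H} dG dH (y , Gy) (z , Hz) c = leaf true , leaf true ,
  (λ x → sym (∧-conicalˡ (G x) (H z) (sym (value x z)))) ,
  (λ w → sym (∧-conicalʳ (G y) (H w) (sym (value y w)))) , z≤n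
  where
  value : ∀ x w → true ≡ G x ∧ H w
  value x w = trans (c (mix S x w)) (mix-∧ S dG dH x w)

module Restriction {m} (S : Fin m → Bool) {G H : BoolFun m}
                   (dG : DependsOn S G) (dH : DependsOn (co S) H) {k : Fin m} (Sk : S k ≡ true) where

  G[_] : Bool → BoolFun m
  G[ b ] x = G (upd x k b)

  restriction-dependsOn : ∀ b → DependsOn S G[ b ]
  restriction-dependsOn b x y p = dG _ _ λ k' Sk' → upd-cong k b k' (p k' Sk')

  H-ignores-k : ∀ x b → H (upd x k b) ≡ H x
  H-ignores-k x b = dH _ _ λ k' coSk' → upd-other x b λ { refl → false≢true (trans (sym (cong not Sk)) coSk') }

  restriction-computes : ∀ {T} → Computes T (λ x → G x ∧ H x) → ∀ b →
    Computes (rename (assign k b) T) (λ x → G[ b ] x ∧ H x)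
  restriction-computes {T} c b x =
    trans (eval-rename (assign k b) T x) (trans (c (upd x k b)) (cong (G[ b ] x ∧_) (H-ignores-k x b)))

  -- Querying k first: the G-tree branches on k, H keeps the partner of the deeper branch.
  join : ∀ {D} → SplitTrees G[ false ] H D → SplitTrees G[ true ] H D → SplitTrees G H (suc D)
  join {D} (a₀ , h₀ , c₀ , ch₀ , p₀) (a₁ , h₁ , c₁ , ch₁ , p₁) with depth a₀ ≤? depth a₁
  ... | yes a₀≤a₁ = node k a₀ a₁ , h₁ , node-computes (dependsOn-ext dG) k {a₀} {a₁} c₀ c₁ , ch₁ ,
                    s≤s (subst (λ a → a + depth h₁ ≤ D) (sym (m≤n⇒m⊔n≡n a₀≤a₁)) p₁)
  ... | no  a₀≰a₁ = node k a₀ a₁ , h₀ , node-computes (dependsOn-ext dG) k {a₀} {a₁} c₀ c₁ , ch₀ ,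
                    s≤s (subst (λ a → a + depth h₀ ≤ D) (sym (m≥n⇒m⊔n≡m (≰⇒≥ a₀≰a₁))) p₀)

  dead : ∀ {b b' D} → Unsat G[ b ] → SplitTrees G[ b' ] H D → SplitTrees G[ b ] H D
  dead u (tG , tH , _ , cH , p) = leaf false , tH , (λ x → sym (u x)) , cH , ≤-trans (m≤n+m (depth tH) (depth tG)) p

  -- If each satisfiable restriction of G splits from H within D, then G splits
  -- from H within D + 1 (G itself is satisfiable, so some restriction is).
  split-at : ∀ {D} → Sat G → (∀ b → Sat G[ b ] → SplitTrees G[ b ] H D) → SplitTrees G H (suc D)
  split-at (y , Gy) rec with decSat G[ false ] (dependsOn-ext (restriction-dependsOn false))
                           | decSat G[ true ] (dependsOn-ext (restriction-dependsOn true))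
  ... | inj₁ s₀ | inj₁ s₁ = join (rec false s₀) (rec true s₁)
  ... | inj₁ s₀ | inj₂ u₁ = join (rec false s₀) (dead u₁ (rec false s₀))
  ... | inj₂ u₀ | inj₁ s₁ = join (dead u₀ (rec true s₁)) (rec true s₁)
  ... | inj₂ u₀ | inj₂ u₁ = ⊥-elim (false≢true (trans (sym (unsat (y k) y)) (trans (eG _ _ (upd-self y k)) Gy)))
    where
    eG : Ext G
    eG = dependsOn-ext dG
    unsat : ∀ b → Unsat G[ b ]
    unsat false = u₀
    unsat true  = u₁

-- The inductive step at a root query to a variable on G's side: restrict the
-- tree at that variable and use the hypothesis for the shallower restrictions.
descend : ∀ {m d} → Additive m d → ∀ (S : Fin m → Bool) {k l r} → depth l ⊔ depth r ≤ d →
  ∀ {G H} → DependsOn S G → DependsOn (co S) H → S k ≡ true → Sat G → Sat H →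
  Computes (node k l r) (λ x → G x ∧ H x) → SplitTrees G H (suc (depth l ⊔ depth r))
descend IH S {k} {l} {r} lr≤d dG dH Sk sG sH c = split-at sG λ b sb →
  split-weaken (root b) (IH S (rename (assign k b) (node k l r)) (≤-trans (root b) lr≤d) _ _
                            (restriction-dependsOn b) dH sb sH (restriction-computes {node k l r} c b))
  where
  open Restriction S dG dH Sk
  root : ∀ b → depth (rename (assign k b) (node k l r)) ≤ depth l ⊔ depth r
  root b = depth-rename-root (assign k b) l r (assign-same k b)

additive : ∀ {m} d → Additive m d
additive d       S (leaf b) _ G H dG dH sG sH c = additive-leaf S b dG dH sG sH c
additive (suc d) S (node k l r) (s≤s lr≤d) G H dG dH sG sH c with S k in Sk
... | true  = descend (additive d) S {k} {l} {r} lr≤d dG dH Sk sG sH c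
... | false = split-swap (descend (additive d) (co S) {k} {l} {r} lr≤d dH (dependsOn-co-co dG) (cong not Sk) sH sG
                                  λ x → trans (c x) (∧-comm (G x) (H x)))

rename-computes : ∀ {m m'} (σ : Subst m m') (π : Input m → Input m') → (∀ y → π (apply σ y) ≗ y) →
  ∀ {G : BoolFun m'} → Ext G → ∀ {t} → Computes t (λ x → G (π x)) → Computes (rename σ t) G
rename-computes σ π πσ eG {t} c y = trans (eval-rename σ t y) (trans (c (apply σ y)) (eG _ _ (πσ y)))

module _ {N M : ℕ} where
  open Blocks N M

  ⊗-tree : ∀ {G H s t} → Computes s G → Computes t H →
    Σ (DTree (N + M)) λ T → Computes T (G ⊗ H) × depth T ≤ depth s + depth t
  ⊗-tree {s = s} {t} cs ct = graft s' t' ,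
    (λ x → trans (eval-graft s' t' x) (cong₂ _∧_ (trans (eval-rename toLeft s x) (cs (left x)))
                                                (trans (eval-rename toRight t x) (ct (right x))))) ,
    ≤-trans (depth-graft s' t') (+-mono-≤ (depth-rename toLeft s) (depth-rename toRight t))
    where
    toLeft : Subst N (N + M)
    toLeft i = inj₁ (i ↑ˡ M)
    toRight : Subst M (N + M)
    toRight j = inj₁ (N ↑ʳ j)
    s' : DTree (N + M)
    s' = rename toLeft s
    t' : DTree (N + M)
    t' = rename toRight t

  leftSide : Fin (N + M) → Bool
  leftSide k = [ (λ _ → true) , (λ _ → false) ]′ (splitAt N k)

  keepLeft : Subst (N + M) N
  keepLeft k = [ inj₁ , (λ _ → inj₂ false) ]′ (splitAt N k)

  keepRight : Subst (N + M) M
  keepRight k = [ (λ _ → inj₂ false) , inj₁ ]′ (splitAt N k)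

  left-keepLeft : ∀ y → left (apply keepLeft y) ≗ y
  left-keepLeft y i rewrite Fin.splitAt-↑ˡ N i M = refl

  right-keepRight : ∀ z → right (apply keepRight z) ≗ z
  right-keepRight z j rewrite Fin.splitAt-↑ʳ N M j = refl

  left-dependsOn : ∀ {G : BoolFun N} → Ext G → DependsOn leftSide (λ x → G (left x))
  left-dependsOn eG x y p = eG _ _ λ i → p (i ↑ˡ M) (cong [ _ , _ ]′ (Fin.splitAt-↑ˡ N i M))

  right-dependsOn : ∀ {H : BoolFun M} → Ext H → DependsOn (co leftSide) (λ x → H (right x))
  right-dependsOn eH x y p = eH _ _ λ j → p (N ↑ʳ j) (cong (not ∘ [ _ , _ ]′) (Fin.splitAt-↑ʳ N M j))

  ⊗-split : ∀ {G H} → Ext G → Ext H → Sat G → Sat H →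
    ∀ T → Computes T (G ⊗ H) → SplitTrees G H (depth T)
  ⊗-split {G} {H} eG eH (y , Gy) (z , Hz) T c
    with additive (depth T) leftSide T ≤-refl _ _ (left-dependsOn eG) (right-dependsOn eH)
                  (apply keepLeft y , trans (eG _ _ (left-keepLeft y)) Gy)
                  (apply keepRight z , trans (eH _ _ (right-keepRight z)) Hz) c
  ... | tG , tH , cG , cH , p =
    rename keepLeft tG , rename keepRight tH ,
    rename-computes keepLeft left left-keepLeft eG {tG} cG ,
    rename-computes keepRight right right-keepRight eH {tH} cH ,
    ≤-trans (+-mono-≤ (depth-rename keepLeft tG) (depth-rename keepRight tH)) p

-- Deterministic query complexity of AND_n ∘ g^n.
module _ {N : ℕ} {g : BoolFun N} where

  andBlocks-tree : ∀ {t} → Computes t g → ∀ n →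
    Σ (DTree (n * N)) λ T → Computes T (andBlocks n g) × depth T ≤ n * depth t
  andBlocks-tree ct zero    = leaf true , (λ _ → refl) , z≤n
  andBlocks-tree {t} ct (suc n) with andBlocks-tree ct n
  ... | T , cT , dT with ⊗-tree {s = t} {t = T} ct cT
  ...   | T' , cT' , dT' = T' , cT' , ≤-trans dT' (+-monoʳ-≤ _ dT)

  andBlocks-depth : Ext g → Sat g → ∀ {d} → (∀ t → Computes t g → d ≤ depth t) →
    ∀ n T → Computes T (andBlocks n g) → n * d ≤ depth T
  andBlocks-depth eg sg hd zero    T cT = z≤n
  andBlocks-depth eg (y , gy) hd (suc n) T cT
    with ⊗-split eg (andBlocks-ext n eg) (y , gy) (rep n y , andBlocks-rep n eg gy) T cT
  ... | tG , tH , cG , cH , p = ≤-trans (+-mono-≤ (hd tG cG) (andBlocks-depth eg (y , gy) hd n tH cH)) p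

  -- D(AND_n ∘ g^n) = n·D(g); for unsatisfiable g both sides are 0.
  D-andBlocks : ∀ n {d} → IsD g d → IsD (andBlocks n g) (n * d)
  D-andBlocks n {d} ((t , ct , dt) , least) with andBlocks-tree ct n
  ... | T , cT , dT = (T , cT , ≤-trans dT (*-monoʳ-≤ n dt)) , lower
    where
    eg : Ext g
    eg = computes-ext {t = t} ct
    lower : ∀ k → (Σ (DTree (n * N)) λ T' → Computes T' (andBlocks n g) × depth T' ≤ k) → n * d ≤ k
    lower k (T' , cT' , dT') with decSat g eg
    ... | inj₁ sg = ≤-trans (andBlocks-depth eg sg (λ t' ct' → least _ (t' , ct' , ≤-refl)) n T' cT') dT'
    ... | inj₂ ug = ≤-trans (*-monoʳ-≤ n (least 0 (leaf false , (λ x → sym (ug x)) , z≤n)))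
                            (≤-trans (≤-reflexive (*-zeroʳ n)) z≤n)

Certified : ∀ {m} → Bool → BoolFun m → ℕ → Set
Certified {m} b f k = ∀ x → f x ≡ b →
  Σ (PartialAssignment m) λ ρ → IsCertificate f b ρ × Consistent x ρ × len ρ ≤ k

certified-transfer : ∀ {m} {b} {f : BoolFun m} {k} → Certified b f k →
  ∀ {x y} → x ≗ y → f x ≡ b → f y ≡ b
certified-transfer P {x} {y} x≗y fx with P x fx
... | _ , cert , cx , _ = cert y (consistent-resp x≗y (λ _ → refl) cx)

certified-ext : ∀ {m} {b} {f : BoolFun m} {k} → Certified b f k → Ext f
certified-ext {b = b} {f} P x y x≗y with f x Bool.≟ b | f y Bool.≟ b
... | yes fx | _      = trans fx (sym (certified-transfer P x≗y fx))
... | no ¬fx | yes fy = ⊥-elim (¬fx (certified-transfer P (sym ∘ x≗y) fy))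
... | no ¬fx | no ¬fy = trans (¬-not ¬fx) (sym (¬-not ¬fy))

module _ {N M : ℕ} where
  open Blocks N M

  ⊗-certified-true : ∀ {G H a b} → Certified true G a → Certified true H b → Certified true (G ⊗ H) (a + b)
  ⊗-certified-true {G} {H} PG PH x Fx with PG (left x) (∧-conicalˡ _ _ Fx) | PH (right x) (∧-conicalʳ _ _ Fx)
  ... | ρ , cρ , xρ , lρ | σ , cσ , xσ , lσ =
    ρ ⊕ σ ,
    (λ y cy → let cl , cr = consistent-split cy in cong₂ _∧_ (cρ _ cl) (cσ _ cr)) ,
    consistent-merge xρ xσ ,
    ≤-trans (≤-reflexive (len-⊕ {N} {M} ρ σ)) (+-mono-≤ lρ lσ)

  ⊗-certified-false : ∀ {G H c} → Certified false G c → Certified false H c → Certified false (G ⊗ H) c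
  ⊗-certified-false {G} {H} PG PH x Fx with G (left x) in Gx
  ... | false with PG (left x) Gx
  ...   | ρ , cρ , xρ , lρ = ρ ⊕ empty ,
    (λ y cy → cong (_∧ H (right y)) (cρ _ (proj₁ (consistent-split cy)))) ,
    consistent-merge xρ (consistent-empty _) ,
    ≤-trans (≤-reflexive (trans (len-⊕ {N} {M} ρ empty)
                                (trans (cong (len ρ +_) (len-empty M)) (+-identityʳ _)))) lρ
  ⊗-certified-false {G} {H} PG PH x Fx | true with PH (right x) Fx
  ...   | σ , cσ , xσ , lσ = empty ⊕ σ ,
    (λ y cy → trans (cong (G (left y) ∧_) (cσ _ (proj₂ (consistent-split cy)))) (∧-zeroʳ _)) ,
    consistent-merge (consistent-empty _) xσ ,
    ≤-trans (≤-reflexive (trans (len-⊕ {N} {M} empty σ) (cong (_+ len σ) (len-empty N)))) lσ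

  module Section {G : BoolFun N} {H : BoolFun M} (eG : Ext G) (eH : Ext H)
                 {b π x} (cert : IsCertificate (G ⊗ H) b π) (xπ : Consistent x π) where

    section-left : ∀ y → Consistent y (left π) → G y ∧ H (right x) ≡ b
    section-left y cy =
      trans (sym (⊗-⊕ eG eH y (right x))) (cert (y ⊕ right x) (consistent-glue cy (consistent-right xπ)))

    section-right : ∀ z → Consistent z (right π) → G (left x) ∧ H z ≡ b
    section-right z cz =
      trans (sym (⊗-⊕ eG eH (left x) z)) (cert (left x ⊕ z) (consistent-glue (consistent-left xπ) cz))

  -- A 0-certificate of G ⊗ H at (x, z) with H z = 1 restricts to a 0-certificate
  -- of G at x of no greater length.
  ⊗-certified-false-left : ∀ {G H k} → Ext G → Ext H → Sat H →
    Certified false (G ⊗ H) k → Certified false G k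
  ⊗-certified-false-left {G} {H} eG eH (z , Hz) P x Gx
    with P (x ⊕ z) (trans (⊗-⊕ eG eH x z) (cong (_∧ H z) Gx))
  ... | π , cert , xπ , lπ =
    left π ,
    (λ y cy → trans (sym (∧-identityʳ (G y))) (trans (cong (G y ∧_) (sym Hz')) (section-left y cy))) ,
    consistent-resp (left-⊕ x z) (λ _ → refl) (consistent-left xπ) ,
    ≤-trans (≤-trans (m≤m+n _ _) (≤-reflexive (sym (len-blocks N π)))) lπ
    where
    open Section eG eH cert xπ
    Hz' : H (right (x ⊕ z)) ≡ true
    Hz' = trans (eH _ _ (right-⊕ x z)) Hz

≤-quotient : ∀ n {a k} → suc n * a ≤ k → a ≤ k / suc n
≤-quotient n {a} {k} p = begin
  a                 ≡⟨ m*n/n≡m a (suc n) ⟨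
  a * suc n / suc n ≤⟨ /-monoˡ-≤ (suc n) (subst (_≤ k) (*-comm (suc n) a) p) ⟩
  k / suc n         ∎
  where open ≤-Reasoning

quotient-≤ : ∀ n k → suc n * (k / suc n) ≤ k
quotient-≤ n k = subst (_≤ k) (*-comm (k / suc n) (suc n)) (m/n*n≤m k (suc n))

-- Certificate complexity of AND_n ∘ g^n.
module _ {N : ℕ} {g : BoolFun N} where

  andBlocks-certified-true : ∀ {c} → Certified true g c → ∀ n → Certified true (andBlocks n g) (n * c)
  andBlocks-certified-true P zero    x _ = empty , (λ _ _ → refl) , consistent-empty x , ≤-reflexive (len-empty 0)
  andBlocks-certified-true P (suc n) = ⊗-certified-true P (andBlocks-certified-true P n)

  andBlocks-certified-false : ∀ {c} → Certified false g c → ∀ n → Certified false (andBlocks n g) c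
  andBlocks-certified-false P zero    x ()
  andBlocks-certified-false P (suc n) = ⊗-certified-false P (andBlocks-certified-false P n)

  Short : Input N → ℕ → ℕ → Set
  Short x n ℓ = Σ (PartialAssignment N) λ σ → IsCertificate g true σ × Consistent x σ × n * len σ ≤ ℓ

  -- Adding one more certificate ρ of g at x: the shorter of ρ and σ is short
  -- with respect to the total length.
  short-step : ∀ {x n ρ ℓ} → IsCertificate g true ρ → Consistent x ρ → Short x (suc n) ℓ →
    Short x (suc (suc n)) (len ρ + ℓ)
  short-step {n = n} {ρ} cρ xρ (σ , cσ , xσ , bσ) with len ρ ≤? len σ
  ... | yes ρ≤σ = ρ , cρ , xρ , +-monoʳ-≤ (len ρ) (≤-trans (*-monoʳ-≤ (suc n) ρ≤σ) bσ)
  ... | no  ρ≰σ = σ , cσ , xσ , +-mono-≤ (≰⇒≥ ρ≰σ) bσ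

  module Halves (eg : Ext g) {x} (n : ℕ) {π} (cert : IsCertificate (andBlocks (suc n) g) true π)
                (xπ : Consistent (rep (suc n) x) π) where
    open Blocks N (n * N)
    open Section eg (andBlocks-ext n eg) cert xπ

    first : PartialAssignment N
    first = left π

    rest : PartialAssignment (n * N)
    rest = right π

    first-certificate : IsCertificate g true first
    first-certificate y cy = ∧-conicalˡ _ _ (section-left y cy)

    first-consistent : Consistent x first
    first-consistent = consistent-resp (left-⊕ x (rep n x)) (λ _ → refl) (consistent-left xπ)

    rest-certificate : IsCertificate (andBlocks n g) true rest
    rest-certificate z cz = ∧-conicalʳ _ _ (section-right z cz)

    rest-consistent : Consistent (rep n x) rest
    rest-consistent = consistent-resp (right-⊕ x (rep n x)) (λ _ → refl) (consistent-right xπ)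

    len-halves : len π ≡ len first + len rest
    len-halves = len-blocks N π

  -- A 1-certificate π of AND_(n+1) ∘ g^(n+1) at (x, …, x) consists of n+1
  -- 1-certificates of g at x; the shortest has length at most len π / (n+1).
  shortest-block : Ext g → ∀ {x} → g x ≡ true → ∀ n π →
    IsCertificate (andBlocks (suc n) g) true π → Consistent (rep (suc n) x) π →
    Short x (suc n) (len π)
  shortest-block eg gx zero π cert xπ =
    subst (Short _ 1) (sym len-halves) (first , first-certificate , first-consistent , +-monoʳ-≤ (len first) z≤n)
    where open Halves eg zero cert xπ
  shortest-block eg gx (suc n) π cert xπ =
    subst (Short _ (suc (suc n))) (sym len-halves)
          (short-step {n = n} first-certificate first-consistent
                      (shortest-block eg gx n rest rest-certificate rest-consistent))
    where open Halves eg (suc n) cert xπ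

  -- C_1 lower bound: a 1-certificate of length k at (x, …, x) yields one of
  -- length ⌊k/(n+1)⌋ at x, so (n+1)·C_1(g) ≤ k.
  andBlocks-C1-lower : Ext g → ∀ n {c k} → (∀ k' → Certified true g k' → c ≤ k') →
    Certified true (andBlocks (suc n) g) k → suc n * c ≤ k
  andBlocks-C1-lower eg n {k = k} least P = ≤-trans (*-monoʳ-≤ (suc n) (least _ certified)) (quotient-≤ n k)
    where
    certified : Certified true g (k / suc n)
    certified x gx with P (rep (suc n) x) (andBlocks-rep (suc n) eg gx)
    ... | π , cert , xπ , lπ with shortest-block eg gx n π cert xπ
    ...   | σ , cσ , xσ , bσ = σ , cσ , xσ , ≤-quotient n (≤-trans bσ lπ)

  -- C_0 lower bound: pad a 0-input of g by 1-inputs of the other blocks.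
  andBlocks-C0-lower : Ext g → ∀ n {k} → Certified false (andBlocks (suc n) g) k → Certified false g k
  andBlocks-C0-lower eg n P with decSat g eg
  ... | inj₁ (y , gy) = ⊗-certified-false-left eg (andBlocks-ext n eg) (rep n y , andBlocks-rep n eg gy) P
  ... | inj₂ ug       = λ x _ →
    empty , (λ y _ → ug y) , consistent-empty x , ≤-trans (≤-reflexive (len-empty N)) z≤n

  C1-andBlocks : ∀ n {c} → IsC true g c → IsC true (andBlocks (suc n) g) (suc n * c)
  C1-andBlocks n (P , least) =
    andBlocks-certified-true P (suc n) , λ k → andBlocks-C1-lower (certified-ext P) n least

  C0-andBlocks : ∀ n {c} → IsC false g c → IsC false (andBlocks (suc n) g) c
  C0-andBlocks n (P , least) =
    andBlocks-certified-false P (suc n) , λ k Q → least k (andBlocks-C0-lower (certified-ext P) n Q)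

-- S ⊆ {0,1}^m is the disjoint union of K subcubes, each fixing at most k
-- variables; DisjointCubeCover b f k is Partition (λ x → f x ≡ b) k.
Partition : ∀ {m} → (Input m → Set) → ℕ → Set
Partition {m} S k = Σ ℕ λ K → Σ (Fin K → PartialAssignment m) λ ρ →
    (∀ i → len (ρ i) ≤ k)
  × (∀ i x → Consistent x (ρ i) → S x)
  × (∀ x → S x → Σ (Fin K) λ i → Consistent x (ρ i))
  × (∀ i j x → Consistent x (ρ i) → Consistent x (ρ j) → i ≡ j)

partition-weaken : ∀ {m} {S : Input m → Set} {k k'} → k ≤ k' → Partition S k → Partition S k'
partition-weaken k≤k' (K , ρ , l , s , c , d) = K , ρ , (λ i → ≤-trans (l i) k≤k') , s , c , d

partition-resp : ∀ {m} {S T : Input m → Set} {k} → (∀ x → S x → T x) → (∀ x → T x → S x) →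
  Partition S k → Partition T k
partition-resp S⇒T T⇒S (K , ρ , l , s , c , d) =
  K , ρ , l , (λ i x cx → S⇒T x (s i x cx)) , (λ x t → c x (T⇒S x t)) , d

partition-all : ∀ {m} → Partition {m} (λ _ → ⊤) 0
partition-all {m} = 1 , (λ _ → empty) , (λ _ → ≤-reflexive (len-empty m)) , (λ _ _ _ → tt) ,
  (λ x _ → Fin.zero , consistent-empty x) , λ { Fin.zero Fin.zero x _ _ → refl }

partition-⊎ : ∀ {m} {S T : Input m → Set} {k} →
  Partition S k → Partition T k → (∀ x → S x → T x → ⊥) →
  Partition (λ x → S x ⊎ T x) k
partition-⊎ {m} {S} {T} {k} (K₁ , ρ , l₁ , s₁ , c₁ , d₁) (K₂ , σ , l₂ , s₂ , c₂ , d₂) S∩T=∅ =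
  K₁ + K₂ , π , length , sound , cover , disjoint
  where
  π : Fin (K₁ + K₂) → PartialAssignment m
  π i = [ ρ , σ ]′ (splitAt K₁ i)

  length : ∀ i → len (π i) ≤ k
  length i with splitAt K₁ i
  ... | inj₁ p = l₁ p
  ... | inj₂ q = l₂ q

  sound : ∀ i x → Consistent x (π i) → S x ⊎ T x
  sound i x cx with splitAt K₁ i
  ... | inj₁ p = inj₁ (s₁ p x cx)
  ... | inj₂ q = inj₂ (s₂ q x cx)

  cover : ∀ x → S x ⊎ T x → Σ (Fin (K₁ + K₂)) λ i → Consistent x (π i)
  cover x (inj₁ sx) with c₁ x sx
  ... | p , cp = p ↑ˡ K₂ , subst (Consistent x ∘ [ ρ , σ ]′) (sym (Fin.splitAt-↑ˡ K₁ p K₂)) cp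
  cover x (inj₂ tx) with c₂ x tx
  ... | q , cq = K₁ ↑ʳ q , subst (Consistent x ∘ [ ρ , σ ]′) (sym (Fin.splitAt-↑ʳ K₁ K₂ q)) cq

  disjoint : ∀ i j x → Consistent x (π i) → Consistent x (π j) → i ≡ j
  disjoint i j x ci cj with splitAt K₁ i in ei | splitAt K₁ j in ej
  ... | inj₁ p | inj₁ p' =
    trans (sym (Fin.splitAt⁻¹-↑ˡ ei)) (trans (cong (_↑ˡ K₂) (d₁ p p' x ci cj)) (Fin.splitAt⁻¹-↑ˡ ej))
  ... | inj₂ q | inj₂ q' =
    trans (sym (Fin.splitAt⁻¹-↑ʳ ei)) (trans (cong (K₁ ↑ʳ_) (d₂ q q' x ci cj)) (Fin.splitAt⁻¹-↑ʳ ej))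
  ... | inj₁ p | inj₂ q' = ⊥-elim (S∩T=∅ x (s₁ p x ci) (s₂ q' x cj))
  ... | inj₂ q | inj₁ p' = ⊥-elim (S∩T=∅ x (s₁ p' x cj) (s₂ q x ci))

module _ {N M : ℕ} where
  open Blocks N M

  partition-× : ∀ {S : Input N → Set} {T : Input M → Set} {a b} → Partition S a → Partition T b →
    Partition (λ x → S (left x) × T (right x)) (a + b)
  partition-× {S} {T} {a} {b} (K₁ , ρ , l₁ , s₁ , c₁ , d₁) (K₂ , σ , l₂ , s₂ , c₂ , d₂) =
    K₁ * K₂ , π , length , sound , cover , disjoint
    where
    π : Fin (K₁ * K₂) → PartialAssignment (N + M)
    π i = ρ (proj₁ (remQuot {K₁} K₂ i)) ⊕ σ (proj₂ (remQuot {K₁} K₂ i))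

    length : ∀ i → len (π i) ≤ a + b
    length i = ≤-trans (≤-reflexive (len-⊕ (ρ _) (σ _))) (+-mono-≤ (l₁ _) (l₂ _))

    sound : ∀ i x → Consistent x (π i) → S (left x) × T (right x)
    sound i x cx = let cl , cr = consistent-split cx in s₁ _ _ cl , s₂ _ _ cr

    cover : ∀ x → S (left x) × T (right x) → Σ (Fin (K₁ * K₂)) λ i → Consistent x (π i)
    cover x (sx , tx) with c₁ _ sx | c₂ _ tx
    ... | p , cp | q , cq = combine p q ,
      subst (λ pq → Consistent x (ρ (proj₁ pq) ⊕ σ (proj₂ pq))) (sym (Fin.remQuot-combine {K₁} {K₂} p q))
            (consistent-merge cp cq)

    disjoint : ∀ i j x → Consistent x (π i) → Consistent x (π j) → i ≡ j
    disjoint i j x ci cj =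
      let cli , cri = consistent-split ci ; clj , crj = consistent-split cj in
      trans (sym (Fin.combine-remQuot {K₁} K₂ i))
            (trans (cong₂ combine (d₁ _ _ _ cli clj) (d₂ _ _ _ cri crj)) (Fin.combine-remQuot {K₁} K₂ j))

  partition-left : ∀ {G : BoolFun N} {b c} → Partition (λ y → G y ≡ b) c → Partition (λ x → G (left x) ≡ b) c
  partition-left P = partition-resp (λ _ → proj₁) (λ _ e → e , tt)
                                    (partition-weaken (≤-reflexive (+-identityʳ _)) (partition-× P partition-all))

  ⊗-partition-true : ∀ {G H a b} → Partition (λ y → G y ≡ true) a → Partition (λ z → H z ≡ true) b →
    Partition (λ x → (G ⊗ H) x ≡ true) (a + b)
  ⊗-partition-true PG PH = partition-resp (λ _ (p , q) → cong₂ _∧_ p q) (λ _ e → ∧-conicalˡ _ _ e , ∧-conicalʳ _ _ e)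
                                          (partition-× PG PH)

  -- (G ⊗ H) x = 0 iff G = 0 on the left block, or G = 1 there and H = 0 on the right block.
  ⊗-partition-false : ∀ {G H c₀ c₁ b} →
    Partition (λ y → G y ≡ false) c₀ → Partition (λ y → G y ≡ true) c₁ →
    Partition (λ z → H z ≡ false) b → c₀ ≤ c₁ + b → Partition (λ x → (G ⊗ H) x ≡ false) (c₁ + b)
  ⊗-partition-false {G} {H} P₀ P₁ PH c₀≤ =
    partition-resp to from (partition-⊎ (partition-weaken c₀≤ (partition-left P₀)) (partition-× P₁ PH)
                                        λ x p (q , _) → false≢true (trans (sym p) q))
    where
    to : ∀ x → G (left x) ≡ false ⊎ (G (left x) ≡ true × H (right x) ≡ false) → (G ⊗ H) x ≡ false
    to x (inj₁ p)       = cong (_∧ H (right x)) p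
    to x (inj₂ (p , q)) = cong₂ _∧_ p q
    from : ∀ x → (G ⊗ H) x ≡ false → G (left x) ≡ false ⊎ (G (left x) ≡ true × H (right x) ≡ false)
    from x e with G (left x)
    ... | false = inj₁ refl
    ... | true  = inj₂ (refl , e)

-- Unambiguous certificate complexity of AND_n ∘ g^n.
module _ {N : ℕ} {g : BoolFun N} where

  UP1-andBlocks : ∀ {a} → Partition (λ y → g y ≡ true) a →
    ∀ n → Partition (λ x → andBlocks n g x ≡ true) (n * a)
  UP1-andBlocks P zero    = partition-resp (λ _ _ → refl) (λ _ _ → tt) partition-all
  UP1-andBlocks P (suc n) = ⊗-partition-true P (UP1-andBlocks P n)

  UP0-andBlocks : ∀ {a b} → Partition (λ y → g y ≡ true) a → Partition (λ y → g y ≡ false) b →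
    ∀ n → Partition (λ x → andBlocks (suc n) g x ≡ false) (n * a + b)
  UP0-andBlocks P₁ P₀ zero =
    partition-resp (λ _ e → trans (∧-identityʳ _) e) (λ _ e → trans (sym (∧-identityʳ _)) e)
                   (partition-left P₀)
  UP0-andBlocks {a} {b} P₁ P₀ (suc n) =
    partition-weaken (≤-reflexive (sym (+-assoc a (n * a) b)))
      (⊗-partition-false P₀ P₁ (UP0-andBlocks P₁ P₀ n) (≤-trans (m≤n+m b (n * a)) (m≤n+m _ a)))

module Negation {m} {f f' : BoolFun m} (f'≡¬f : ∀ x → f' x ≡ not (f x)) where

  f≡¬f' : ∀ x → f x ≡ not (f' x)
  f≡¬f' x = trans (sym (not-involutive (f x))) (cong not (sym (f'≡¬f x)))

  negate-computes : ∀ {t} {h h' : BoolFun m} → (∀ x → h' x ≡ not (h x)) → Computes t h → Computes (negate t) h'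
  negate-computes {t} h'≡¬h c x = trans (eval-negate t x) (trans (cong not (c x)) (sym (h'≡¬h x)))

  D-negation : ∀ {d} → IsD f d → IsD f' d
  D-negation ((t , c , dt) , least) =
    (negate t , negate-computes {t} f'≡¬f c , ≤-trans (≤-reflexive (depth-negate t)) dt) ,
    λ k (t' , c' , dt') →
      least k (negate t' , negate-computes {t'} f≡¬f' c' , ≤-trans (≤-reflexive (depth-negate t')) dt')

  certified-negation : ∀ {b k} → Certified b f k → Certified (not b) f' k
  certified-negation P x f'x with P x (Bool.not-injective (trans (sym (f'≡¬f x)) f'x))
  ... | ρ , cert , xρ , l = ρ , (λ y cy → trans (f'≡¬f y) (cong not (cert y cy))) , xρ , l

  certified-negation⁻ : ∀ {b k} → Certified (not b) f' k → Certified b f k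
  certified-negation⁻ P x fx with P x (trans (f'≡¬f x) (cong not fx))
  ... | ρ , cert , xρ , l = ρ , (λ y cy → Bool.not-injective (trans (sym (f'≡¬f y)) (cert y cy))) , xρ , l

  C-negation : ∀ {b c} → IsC b f c → IsC (not b) f' c
  C-negation (P , least) = certified-negation P , λ k P' → least k (certified-negation⁻ P')

  partition-negation : ∀ {b k} → Partition (λ x → f x ≡ b) k → Partition (λ x → f' x ≡ not b) k
  partition-negation = partition-resp (λ x p → trans (f'≡¬f x) (cong not p))
                                      (λ x q → Bool.not-injective (trans (sym (f'≡¬f x)) q))

OR-deMorgan : ∀ n (v : Input n) → OR n v ≡ not (AND n (not ∘ v))
OR-deMorgan zero    v = refl
OR-deMorgan (suc n) v rewrite OR-deMorgan n (v ∘ Fin.suc) with v Fin.zero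
... | true  = refl
... | false = refl

lemma4 : (N n : ℕ) → 1 ≤ n → (g : BoolFun N) →
    (∀ d → IsD g d → IsD (compose {n} (AND n) g) (n * d) × IsD (compose {n} (OR n) g) (n * d))
    × (∀ c → IsC false g c → IsC false (compose {n} (OR n) g) (n * c) × IsC false (compose {n} (AND n) g) c)
    × (∀ c → IsC true g c → IsC true (compose {n} (OR n) g) c × IsC true (compose {n} (AND n) g) (n * c))
    × (∀ u₀ u₁ → IsUP false g u₀ → IsUP true g u₁ →
         (∀ v → IsUP false (compose {n} (OR n) g) v → v ≤ n * u₀)
       × (∀ v → IsUP true (compose {n} (OR n) g) v → v ≤ (n ∸ 1) * u₀ + u₁)
       × (∀ v → IsUP false (compose {n} (AND n) g) v → v ≤ (n ∸ 1) * u₁ + u₀)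
       × (∀ v → IsUP true (compose {n} (AND n) g) v → v ≤ n * u₁))
lemma4 N n@(suc m) _ g =
  (λ d D → D-andBlocks n D , OR.D-negation (D-andBlocks n (¬g.D-negation D))) ,
  (λ c C → OR.C-negation (C1-andBlocks m (¬g.C-negation C)) , C0-andBlocks m C) ,
  (λ c C → OR.C-negation (C0-andBlocks m (¬g.C-negation C)) , C1-andBlocks m C) ,
  λ u₀ u₁ (P₀ , _) (P₁ , _) →
    (λ v (_ , least) → least _ (OR.partition-negation (UP1-andBlocks (¬g.partition-negation P₀) n))) ,
    (λ v (_ , least) → least _ (OR.partition-negation
                                  (UP0-andBlocks (¬g.partition-negation P₀) (¬g.partition-negation P₁) m))) ,
    (λ v (_ , least) → least _ (UP0-andBlocks P₁ P₀ m)) ,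
    (λ v (_ , least) → least _ (UP1-andBlocks P₁ n))
  where
  -- ¬g, and OR_n ∘ g^n = ¬ (AND_n ∘ (¬g)^n)
  module ¬g = Negation {f = g} {f' = not ∘ g} (λ _ → refl)
  module OR = Negation {f = andBlocks n (not ∘ g)} {f' = compose {n} (OR n) g}
                       (λ x → OR-deMorgan n (λ i → g (λ j → x (combine i j))))
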